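{- Let $(G,\sigma)$ be a connected signed graph and let $(H,\sigma)$ be an induced subgraph of $(G,\sigma)$. If $r(G,\sigma)=r(H,\sigma)$ or $r(G,\sigma)=r(H,\sigma)+1$, then every vertex of $G$ not in $V(H)$ has a neighbor in $V(H)$.
   Context: A signed graph $(G,\sigma)$ is a simple graph $G$ with a map $\sigma:E(G)\to\{+,-\}$. Its adjacency matrix $A(G,\sigma)$ has $(i,j)$-entry $\sigma(v_iv_j)$ if $v_iv_j\in E(G)$ and $0$ otherwise; $r(G,\sigma)$ denotes the rank of $A(G,\sigma)$. An induced subgraph $(H,\sigma)$ carries the restricted signature. -}

module Defs where

open import Data.Nat using (ℕ; zero; suc; _≤_)
open import Data.Fin using (Fin)
import Data.Fin as Fin
open import Data.Maybe using (Maybe; just; nothing)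
open import Data.Product using (Σ; ∃; _×_; _,_)
open import Data.Rational using (ℚ; 0ℚ; 1ℚ; -_; _+_; _*_)
open import Relation.Binary.PropositionalEquality using (_≡_)
open import Relation.Binary.Construct.Closure.ReflexiveTransitive using (Star)
open import Function.Definitions using (Injective)

data Sign : Set where
  plus minus : Sign

-- A signed (simple) graph on vertex set Fin n:
-- w i j = nothing  : i and j are not adjacent
-- w i j = just s   : i and j are adjacent, edge has sign s
record SignedGraph (n : ℕ) : Set where
  field
    w        : Fin n → Fin n → Maybe Sign
    sym      : ∀ i j → w i j ≡ w j i
    loopless : ∀ i → w i i ≡ nothing
open SignedGraph public

Adj : ∀ {n} → SignedGraph n → Fin n → Fin n → Set
Adj G i j = ∃ λ s → w G i j ≡ just s

Connected : ∀ {n} → SignedGraph n → Set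
Connected {n} G = ∀ (i j : Fin n) → Star (Adj G) i j

entry : Maybe Sign → ℚ
entry nothing      = 0ℚ
entry (just plus)  = 1ℚ
entry (just minus) = - 1ℚ

adjMatrix : ∀ {n} → SignedGraph n → Fin n → Fin n → ℚ
adjMatrix G i j = entry (w G i j)

induced : ∀ {m n} → SignedGraph n → (ι : Fin m → Fin n) → Injective _≡_ _≡_ ι → SignedGraph m
induced G ι inj = record
  { w        = λ i j → w G (ι i) (ι j)
  ; sym      = λ i j → sym G (ι i) (ι j)
  ; loopless = λ i → loopless G (ι i)
  }

∑ : ∀ {k} → (Fin k → ℚ) → ℚ
∑ {zero}  f = 0ℚ
∑ {suc k} f = f Fin.zero + ∑ (λ j → f (Fin.suc j))

LinIndep : ∀ {m k} → (Fin k → Fin m → ℚ) → Set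
LinIndep {m} {k} v =
  ∀ (a : Fin k → ℚ) → (∀ (i : Fin m) → ∑ (λ j → a j * v j i) ≡ 0ℚ) → ∀ j → a j ≡ 0ℚ

cols : ∀ {m n k} → (Fin m → Fin n → ℚ) → (Fin k → Fin n) → Fin k → Fin m → ℚ
cols M s j i = M i (s j)

HasRank : ∀ {m n} → (Fin m → Fin n → ℚ) → ℕ → Set
HasRank {m} {n} M r =
  (Σ (Fin r → Fin n) λ s → LinIndep (cols M s)) ×
  (∀ k (s : Fin k → Fin n) → LinIndep (cols M s) → k ≤ r)

-- Suppose a vertex v outside H has no neighbour in H. By connectedness v has a
-- neighbour u, also outside H. Add the columns of u and v to a maximal independent
-- set of columns of A(H,σ), read as columns of A(G,σ). In row v only column u is
-- nonzero, and among the rows u and V(H) column v is nonzero only in row u, so the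
-- enlarged set is still independent and r(G,σ) ≥ r(H,σ) + 2.
module Submission where

open import Defs
open import Data.Nat using (ℕ; suc; _≤_)
open import Data.Nat.Properties using (≤-trans; n≤1+n; 1+n≰n)
open import Data.Fin using (Fin; zero; suc)
open import Data.Fin.Properties using (any?)
open import Data.Vec.Functional using (_∷_)
open import Data.Sum using (_⊎_; inj₁; inj₂)
open import Data.Product using (∃; _,_)
open import Data.Maybe using (just; nothing)
open import Data.Empty using (⊥-elim)
open import Data.Rational using (ℚ; 0ℚ; 1ℚ; _+_; _*_; 1/_; ≢-nonZero)
open import Data.Rational.Properties
  using (+-identityˡ; +-identityʳ; *-identityʳ; *-zeroˡ; *-zeroʳ; *-assoc; *-inverseʳ)
open import Relation.Nullary using (¬_; yes; no)
open import Relation.Unary using (Decidable)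
open import Relation.Binary.PropositionalEquality
  using (_≡_; _≢_; refl; trans; cong; module ≡-Reasoning)
  renaming (sym to ≡-sym)
open import Relation.Binary.Construct.Closure.ReflexiveTransitive using (ε; _◅_)
open import Function using (_∘_)
open import Function.Definitions using (Injective)

p*q≡0⇒p≡0 : ∀ p {q} → q ≢ 0ℚ → p * q ≡ 0ℚ → p ≡ 0ℚ
p*q≡0⇒p≡0 p {q} q≢0 pq≡0 = begin
  p                   ≡⟨ ≡-sym (*-identityʳ p) ⟩
  p * 1ℚ              ≡⟨ cong (p *_) (≡-sym (*-inverseʳ q)) ⟩
  p * (q * 1/ q)      ≡⟨ ≡-sym (*-assoc p q _) ⟩
  (p * q) * 1/ q      ≡⟨ cong (_* 1/ q) pq≡0 ⟩
  0ℚ * 1/ q           ≡⟨ *-zeroˡ (1/ q) ⟩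
  0ℚ                  ∎
  where
  open ≡-Reasoning
  instance _ = ≢-nonZero q≢0

p≡0⇒p+q≡0⇒q≡0 : ∀ {p q} → p ≡ 0ℚ → p + q ≡ 0ℚ → q ≡ 0ℚ
p≡0⇒p+q≡0⇒q≡0 {p} {q} refl p+q≡0 = trans (≡-sym (+-identityˡ q)) p+q≡0

q≡0⇒p+q≡0⇒p≡0 : ∀ {p q} → q ≡ 0ℚ → p + q ≡ 0ℚ → p ≡ 0ℚ
q≡0⇒p+q≡0⇒p≡0 {p} {q} refl p+q≡0 = trans (≡-sym (+-identityʳ p)) p+q≡0

∑-zero : ∀ {k} (f : Fin k → ℚ) → (∀ j → f j ≡ 0ℚ) → ∑ f ≡ 0ℚ
∑-zero {0}     f f≡0 = refl
∑-zero {suc k} f f≡0 rewrite f≡0 zero | ∑-zero (f ∘ suc) (f≡0 ∘ suc) = +-identityʳ 0ℚ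

∑-*-zeroˡ : ∀ {k} (a b : Fin k → ℚ) → (∀ j → a j ≡ 0ℚ) → ∑ (λ j → a j * b j) ≡ 0ℚ
∑-*-zeroˡ a b a≡0 = ∑-zero _ λ j → trans (cong (_* b j) (a≡0 j)) (*-zeroˡ (b j))

∑-*-zeroʳ : ∀ {k} (a b : Fin k → ℚ) → (∀ j → b j ≡ 0ℚ) → ∑ (λ j → a j * b j) ≡ 0ℚ
∑-*-zeroʳ a b b≡0 = ∑-zero _ λ j → trans (cong (a j *_) (b≡0 j)) (*-zeroʳ (a j))

LinIndep-∷-pivot : ∀ {m k} (x : Fin m → ℚ) (v : Fin k → Fin m → ℚ) (r : Fin m) →
  x r ≢ 0ℚ → (∀ j → v j r ≡ 0ℚ) → LinIndep v → LinIndep (x ∷ v)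
LinIndep-∷-pivot x v r xr≢0 v≡0 indep a comb≡0 = coeffs≡0
  where
  a₀≡0 : a zero ≡ 0ℚ
  a₀≡0 = p*q≡0⇒p≡0 _ xr≢0
    (q≡0⇒p+q≡0⇒p≡0 (∑-*-zeroʳ (a ∘ suc) (λ j → v j r) v≡0) (comb≡0 r))
  coeffs≡0 : ∀ j → a j ≡ 0ℚ
  coeffs≡0 zero    = a₀≡0
  coeffs≡0 (suc j) = indep (a ∘ suc) (λ i →
    p≡0⇒p+q≡0⇒q≡0 (trans (cong (_* x i) a₀≡0) (*-zeroˡ (x i))) (comb≡0 i)) j

LinIndep-∷-vanishing : ∀ {m m′ k} (ρ : Fin m′ → Fin m) (x : Fin m → ℚ) (v : Fin k → Fin m → ℚ)
  (r : Fin m) → x r ≢ 0ℚ → (∀ i → x (ρ i) ≡ 0ℚ) → LinIndep (λ j i → v j (ρ i)) →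
  LinIndep (x ∷ v)
LinIndep-∷-vanishing ρ x v r xr≢0 x∘ρ≡0 indep a comb≡0 = coeffs≡0
  where
  tail≡0 : ∀ j → a (suc j) ≡ 0ℚ
  tail≡0 = indep (a ∘ suc) λ i →
    p≡0⇒p+q≡0⇒q≡0 (trans (cong (a zero *_) (x∘ρ≡0 i)) (*-zeroʳ (a zero))) (comb≡0 (ρ i))
  coeffs≡0 : ∀ j → a j ≡ 0ℚ
  coeffs≡0 zero    = p*q≡0⇒p≡0 _ xr≢0
    (q≡0⇒p+q≡0⇒p≡0 (∑-*-zeroˡ (a ∘ suc) (λ j → v j r) tail≡0) (comb≡0 r))
  coeffs≡0 (suc j) = tail≡0 j

module _ {n} (G : SignedGraph n) where

  Adj? : ∀ i → Decidable (Adj G i)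
  Adj? i j with w G i j
  ... | just s  = yes (s , refl)
  ... | nothing = no λ ()

  Adj-sym : ∀ {i j} → Adj G i j → Adj G j i
  Adj-sym {i} {j} (s , eq) = s , trans (sym G j i) eq

  Adj⇒entry≢0 : ∀ {i j} → Adj G i j → adjMatrix G i j ≢ 0ℚ
  Adj⇒entry≢0 (plus  , eq) rewrite eq = λ ()
  Adj⇒entry≢0 (minus , eq) rewrite eq = λ ()

  ¬Adj⇒entry≡0 : ∀ {i j} → ¬ Adj G i j → adjMatrix G i j ≡ 0ℚ
  ¬Adj⇒entry≡0 {i} {j} ¬adj with w G i j
  ... | just s  = ⊥-elim (¬adj (s , refl))
  ... | nothing = refl

  diagonal≡0 : ∀ i → adjMatrix G i i ≡ 0ℚ
  diagonal≡0 i = cong entry (loopless G i)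

  connected⇒neighbour : Connected G → ∀ {i j} → i ≢ j → ∃ (Adj G i)
  connected⇒neighbour conn {i} {j} i≢j with conn i j
  ... | ε       = ⊥-elim (i≢j refl)
  ... | adj ◅ _ = _ , adj

module _ {m n} (G : SignedGraph n) (ι : Fin m → Fin n) (inj : Injective _≡_ _≡_ ι) where

  LinIndep-cols-extend : ∀ {k u v} → Adj G v u → (∀ i → ¬ Adj G v (ι i)) →
    (s : Fin k → Fin m) → LinIndep (cols (adjMatrix (induced G ι inj)) s) →
    LinIndep (cols (adjMatrix G) (u ∷ v ∷ ι ∘ s))
  LinIndep-cols-extend {u = u} {v} vu v↮H s indepH =
    LinIndep-∷-pivot (column u) (cols M (v ∷ ι ∘ s)) v (Adj⇒entry≢0 G vu) row-v≡0
      (LinIndep-∷-vanishing ι (column v) (cols M (ι ∘ s)) u (Adj⇒entry≢0 G (Adj-sym G vu))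
        (λ i → ¬Adj⇒entry≡0 G (v↮H i ∘ Adj-sym G)) indepH)
    where
    M : Fin n → Fin n → ℚ
    M = adjMatrix G
    column : Fin n → Fin n → ℚ
    column j i = M i j
    row-v≡0 : ∀ j → cols M (v ∷ ι ∘ s) j v ≡ 0ℚ
    row-v≡0 zero    = diagonal≡0 G v
    row-v≡0 (suc j) = ¬Adj⇒entry≡0 G (v↮H (s j))

  rank-gap : ∀ {rG rH u v} → Adj G v u → (∀ i → ¬ Adj G v (ι i)) →
    HasRank (adjMatrix G) rG → HasRank (adjMatrix (induced G ι inj)) rH → suc (suc rH) ≤ rG
  rank-gap {u = u} {v} vu v↮H (_ , maximalG) ((s , indepH) , _) =
    maximalG _ (u ∷ v ∷ ι ∘ s) (LinIndep-cols-extend vu v↮H s indepH)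

lemma3p1 : ∀ {m n} (G : SignedGraph n) → Connected G →
    (ι : Fin m → Fin n) (inj : Injective _≡_ _≡_ ι) → 1 ≤ m →
    ∀ (rG rH : ℕ) → HasRank (adjMatrix G) rG → HasRank (adjMatrix (induced G ι inj)) rH →
    (rG ≡ rH ⊎ rG ≡ suc rH) →
    ∀ (v : Fin n) → (∀ i → ¬ (ι i ≡ v)) → ∃ λ i → Adj G v (ι i)
lemma3p1 {suc m} G conn ι inj _ rG rH rankG rankH rank-close v v∉H
  with any? (Adj? G v ∘ ι)
... | yes neighbour = neighbour
... | no  v↮H       = ⊥-elim (contradiction rank-close)
  where
  gap : suc (suc rH) ≤ rG
  gap with connected⇒neighbour G conn (v∉H zero ∘ ≡-sym)
  ... | _ , vu = rank-gap G ι inj vu (λ i adj → v↮H (i , adj)) rankG rankH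
  contradiction : ¬ (rG ≡ rH ⊎ rG ≡ suc rH)
  contradiction (inj₁ refl) = 1+n≰n (≤-trans (n≤1+n _) gap)
  contradiction (inj₂ refl) = 1+n≰n gap
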